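{- Let $\mathcal D=\{\mathbf D_i : i\in I\}$ be a class of upwards-closed dependency notions, for each $i\in I$ let $\gamma_i:\mathbb N\to\mathbb N$ be such that $\mathbf D_i$ is $\gamma_i$-bounded, let $\varphi\in\mathbf{FO}(=\!(\cdot),\mathcal D,\sqcup)$ be a formula in which each $\mathbf D_i$ occurs $k_i$ times, and let $\nu_\varphi(n)=\sum_{i\in I}k_i\gamma_i(n)$. Then for all finite structures $\mathfrak M$ (with domain $M$) and all teams $X$: if $\mathfrak M\models_X\varphi$ then there exists $Y\subseteq X$ with $|Y|\le\nu_\varphi(|M|)$ and $\mathfrak M\models_Y\varphi$.
   Context: Team semantics (lax version). Let $\mathfrak M$ be a structure with domain $M$. A team $X$ is a set of assignments $s: V\to M$ on a common domain $V$; $X(\bar v)=\{s(\bar v): s\in X\}$. First-order parts of formulas are in negation normal form. Satisfaction: literal $\alpha$: every $s\in X$ satisfies $\alpha$ (Tarski); $\psi\vee\theta$: $X=Y\cup Z$ with $\mathfrak M\models_Y\psi$, $\mathfrak M\models_Z\theta$; $\wedge$: both; $\exists v\psi$: some $F: X\to\mathcal P(M)\setminus\{\emptyset\}$ with $\mathfrak M\models_{X[F/v]}\psi$, $X[F/v]=\{s[m/v]: s\in X,m\in F(s)\}$; $\forall v\psi$: $\mathfrak M\models_{X[M/v]}\psi$, $X[M/v]=\{s[m/v]: s\in X,m\in M\}$; $\varphi\sqcup\psi$: $\mathfrak M\models_X\varphi$ or $\mathfrak M\models_X\psi$. Constancy atoms: $\mathfrak M\models_X=\!(\bar v)$ iff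 $s(\bar v)=s'(\bar v)$ for all $s,s'\in X$ ($=\!(\cdot)$: all arities). A $k$-ary dependency notion $\mathbf D$ is an isomorphism-closed class of structures $(M,R)$ with $R$ $k$-ary; $\mathfrak M\models_X\mathbf D\bar v$ iff $(M,X(\bar v))\in\mathbf D$. $\mathbf D$ is upwards-closed if $(M,R)\in\mathbf D$ and $R\subseteq S$ imply $(M,S)\in\mathbf D$. For $\gamma:\mathbb N\to\mathbb N$, $\mathbf D$ is $\gamma$-bounded if for all finite structures $\mathfrak M$ and teams $X$, whenever $\mathfrak M\models_X\mathbf D\bar v$ there is $Y\subseteq X$ with $|Y|\le\gamma(|M|)$ and $\mathfrak M\models_Y\mathbf D\bar v$. -}

module Defs where

open import Data.Nat using (ℕ; zero; suc; _+_; _*_; _≤_; NonZero)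
open import Data.Fin using (Fin)
open import Data.Vec using (Vec; []; _∷_; lookup; _[_]≔_)
import Data.Vec as Vec
open import Data.List using (List; concatMap; allFin; length)
import Data.List as List
open import Data.List.Membership.Propositional using (_∈_)
open import Data.List.Relation.Binary.Subset.Propositional using (_⊆_)
open import Data.Product using (Σ; ∃; ∃-syntax; _×_; _,_)
open import Data.Sum using (_⊎_)
open import Relation.Binary.PropositionalEquality using (_≡_)
open import Relation.Nullary using (¬_)
open import Function.Bundles using (_↔_; Inverse)

record Signature : Set₁ where
  field
    Rel   : Set
    relAr : Rel → ℕ
    Fun   : Set
    funAr : Fun → ℕ
open Signature public

-- A finite (nonempty) structure; its domain is Fin size, so |M| = size.
record Structure (L : Signature) : Set₁ where
  field
    size      : ℕ
    {{nonEmpty}} : NonZero size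
    relI      : (R : Rel L) → Vec (Fin size) (relAr L R) → Set
    funI      : (f : Fun L) → Vec (Fin size) (funAr L f) → Fin size
open Structure public

-- Variables in scope are Fin k (the domain V of the team, |V| = k).
data Term (L : Signature) (k : ℕ) : Set where
  var : Fin k → Term L k
  app : (f : Fun L) → Vec (Term L k) (funAr L f) → Term L k

-- Assignments with domain V = Fin k, and teams (finite sets of assignments,
-- represented by lists; only membership matters).
Assignment : ℕ → ℕ → Set
Assignment n k = Vec (Fin n) k

Team : ℕ → ℕ → Set
Team n k = List (Assignment n k)

module _ {L : Signature} (𝔐 : Structure L) where
  mutual
    evalT : ∀ {k} → Assignment (size 𝔐) k → Term L k → Fin (size 𝔐)
    evalT s (var v)    = lookup s v
    evalT s (app f ts) = funI 𝔐 f (evalTs s ts)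

    evalTs : ∀ {k a} → Assignment (size 𝔐) k → Vec (Term L k) a → Vec (Fin (size 𝔐)) a
    evalTs s []       = []
    evalTs s (t ∷ ts) = evalT s t ∷ evalTs s ts

proj : ∀ {n k a} → Assignment n k → Vec (Fin k) a → Vec (Fin n) a
proj s vs = Vec.map (lookup s) vs

teamRel : ∀ {n k a} → Team n k → Vec (Fin k) a → Vec (Fin n) a → Set
teamRel X vs t = ∃[ s ] (s ∈ X × proj s vs ≡ t)

record DependencyNotion (a : ℕ) : Set₁ where
  field
    holds : (n : ℕ) → (Vec (Fin n) a → Set) → Set
    -- isomorphism closure: if π is an isomorphism (Fin n, R) ≅ (Fin n, R')
    isoClosed : ∀ {n} (π : Fin n ↔ Fin n) (R R' : Vec (Fin n) a → Set) →
                (∀ t → (R t → R' (Vec.map (Inverse.to π) t)) ×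
                       (R' (Vec.map (Inverse.to π) t) → R t)) →
                holds n R → holds n R'
open DependencyNotion public

UpwardsClosed : ∀ {a} → DependencyNotion a → Set₁
UpwardsClosed {a} D = ∀ n (R S : Vec (Fin n) a → Set) →
  holds D n R → (∀ t → R t → S t) → holds D n S

-- γ-bounded: for all finite structures 𝔐 (only the domain matters) and teams X
Bounded : ∀ {a} → (ℕ → ℕ) → DependencyNotion a → Set
Bounded {a} γ D = ∀ n → {{_ : NonZero n}} → ∀ k (X : Team n k) (vs : Vec (Fin k) a) →
  holds D n (teamRel X vs) →
  ∃[ Y ] (Y ⊆ X × length Y ≤ γ n × holds D n (teamRel Y vs))

-- Formulas of FO(=(·), {D_i : i ∈ I}, ⊔) in negation normal form.
-- ∃⁺/∀⁺ quantify a variable not in the current domain (extending it),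
-- ∃ᵒ/∀ᵒ re-quantify a variable already in the domain (overwriting it).

data Formula (L : Signature) {I : Set} (ar : I → ℕ) (k : ℕ) : Set where
  rel   : (R : Rel L) → Vec (Term L k) (relAr L R) → Formula L ar k
  nrel  : (R : Rel L) → Vec (Term L k) (relAr L R) → Formula L ar k
  eq    : Term L k → Term L k → Formula L ar k
  neq   : Term L k → Term L k → Formula L ar k
  const : ∀ {a} → Vec (Fin k) a → Formula L ar k
  dep   : (i : I) → Vec (Fin k) (ar i) → Formula L ar k
  _∨'_  : Formula L ar k → Formula L ar k → Formula L ar k
  _∧'_  : Formula L ar k → Formula L ar k → Formula L ar k
  _⊔'_  : Formula L ar k → Formula L ar k → Formula L ar k
  ∃⁺    : Formula L ar (suc k) → Formula L ar k
  ∀⁺    : Formula L ar (suc k) → Formula L ar k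
  ∃ᵒ    : Fin k → Formula L ar k → Formula L ar k
  ∀ᵒ    : Fin k → Formula L ar k → Formula L ar k

-- ν_φ(n) = Σ_i k_i γ_i(n), computed as the sum of γ_i(n) over all
-- occurrences of dependency atoms D_i in φ.
ν : ∀ {L I} {ar : I → ℕ} {k} → (I → ℕ → ℕ) → Formula L ar k → ℕ → ℕ
ν γ (rel R ts)  n = 0
ν γ (nrel R ts) n = 0
ν γ (eq t u)    n = 0
ν γ (neq t u)   n = 0
ν γ (const vs)  n = 0
ν γ (dep i vs)  n = γ i n
ν γ (φ ∨' ψ)    n = ν γ φ n + ν γ ψ n
ν γ (φ ∧' ψ)    n = ν γ φ n + ν γ ψ n
ν γ (φ ⊔' ψ)    n = ν γ φ n + ν γ ψ n
ν γ (∃⁺ φ)      n = ν γ φ n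
ν γ (∀⁺ φ)      n = ν γ φ n
ν γ (∃ᵒ v φ)    n = ν γ φ n
ν γ (∀ᵒ v φ)    n = ν γ φ n

supNew : ∀ {n k} → Team n k → (Assignment n k → List (Fin n)) → Team n (suc k)
supNew X F = concatMap (λ s → List.map (λ m → m ∷ s) (F s)) X

supOld : ∀ {n k} → Fin k → Team n k → (Assignment n k → List (Fin n)) → Team n k
supOld v X F = concatMap (λ s → List.map (λ m → s [ v ]≔ m) (F s)) X

module Semantics {L : Signature} {I : Set} {ar : I → ℕ}
                 (D : (i : I) → DependencyNotion (ar i)) (𝔐 : Structure L) where
  private
    n = size 𝔐

  _⊨_ : ∀ {k} → Team n k → Formula L ar k → Set
  X ⊨ rel R ts  = ∀ s → s ∈ X → relI 𝔐 R (evalTs 𝔐 s ts)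
  X ⊨ nrel R ts = ∀ s → s ∈ X → ¬ relI 𝔐 R (evalTs 𝔐 s ts)
  X ⊨ eq t u    = ∀ s → s ∈ X → evalT 𝔐 s t ≡ evalT 𝔐 s u
  X ⊨ neq t u   = ∀ s → s ∈ X → ¬ (evalT 𝔐 s t ≡ evalT 𝔐 s u)
  X ⊨ const vs  = ∀ s s' → s ∈ X → s' ∈ X → proj s vs ≡ proj s' vs
  X ⊨ dep i vs  = holds (D i) n (teamRel X vs)
  X ⊨ (φ ∨' ψ)  = ∃[ Y ] ∃[ Z ] (Y ⊆ X × Z ⊆ X × (∀ s → s ∈ X → s ∈ Y ⊎ s ∈ Z)
                                  × Y ⊨ φ × Z ⊨ ψ)
  X ⊨ (φ ∧' ψ)  = X ⊨ φ × X ⊨ ψ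
  X ⊨ (φ ⊔' ψ)  = X ⊨ φ ⊎ X ⊨ ψ
  X ⊨ ∃⁺ φ      = ∃[ F ] ((∀ s → s ∈ X → ∃[ m ] (m ∈ F s)) × supNew X F ⊨ φ)
  X ⊨ ∀⁺ φ      = supNew X (λ _ → allFin n) ⊨ φ
  X ⊨ ∃ᵒ v φ    = ∃[ F ] ((∀ s → s ∈ X → ∃[ m ] (m ∈ F s)) × supOld v X F ⊨ φ)
  X ⊨ ∀ᵒ v φ    = supOld v X (λ _ → allFin n) ⊨ φ

module Submission where

-- Say that a subteam Y ⊆ X anchors a property P of teams inside X if every
-- team Z with Y ⊆ Z ⊆ X has P.  We prove, by induction on φ, that whenever
-- X ⊨ φ there is an anchor Y of "⊨ φ" inside X with |Y| ≤ ν_φ(|M|); taking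
-- Z = Y yields the theorem.  Anchors (rather than plain small subteams) are
-- what makes the induction go through: the subformulas of φ are evaluated on
-- teams between the anchor and X, not on the anchor itself.
--
-- The atoms are handled by flatness (first-order literals, constancy atoms)
-- and by γ-boundedness plus upward closure (dependency atoms).

open import Defs
open import Data.Nat using (ℕ; _≤_; _+_; z≤n; s≤s; NonZero)
open import Data.Nat.Properties using (≤-refl; ≤-trans; +-mono-≤; m≤m+n; m≤n+m)
open import Data.Fin using (Fin)
import Data.Fin as Fin
open import Data.Vec using (Vec; _∷_; _[_]≔_)
open import Data.Vec.Properties using (≡-dec)
open import Data.List using (List; []; _∷_; length; _++_; filter; concatMap; allFin)
import Data.List as List
open import Data.List.Properties using (length-++)
open import Data.List.Membership.Propositional using (_∈_; lose; find)
open import Data.List.Membership.Propositional.Properties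
  using (∈-map⁺; ∈-map⁻; ∈-concatMap⁺; ∈-concatMap⁻; ∈-++⁻; ∈-filter⁺; ∈-filter⁻)
open import Data.List.Relation.Unary.Any using (here; there)
open import Data.List.Relation.Binary.Subset.Propositional using (_⊆_)
open import Data.List.Relation.Binary.Subset.Propositional.Properties
  using (⊆-refl; ⊆-trans; xs⊆xs++ys; xs⊆ys++xs; concatMap⁺; filter-⊆)
open import Data.Product using (∃-syntax; _×_; _,_; proj₂)
open import Data.Sum using (_⊎_; inj₁; inj₂; [_,_])
import Data.Sum as Sum
open import Relation.Binary.PropositionalEquality using (_≡_; refl; sym; subst)
open import Relation.Binary.Definitions using (DecidableEquality)

private variable A B C : Set

++-least : {Ys Zs Xs : List A} → Ys ⊆ Xs → Zs ⊆ Xs → Ys ++ Zs ⊆ Xs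
++-least {Ys = Ys} Ys⊆ Zs⊆ x∈ = [ Ys⊆ , Zs⊆ ] (∈-++⁻ Ys x∈)

length-++-≤ : {Ys Zs : List A} {a b : ℕ} →
  length Ys ≤ a → length Zs ≤ b → length (Ys ++ Zs) ≤ a + b
length-++-≤ {Ys = Ys} ∣Ys∣≤a ∣Zs∣≤b =
  subst (_≤ _) (sym (length-++ Ys)) (+-mono-≤ ∣Ys∣≤a ∣Zs∣≤b)

sources : (R : A → B → Set) (X : List A) (Y' : List B) →
  (∀ {b} → b ∈ Y' → ∃[ a ] (a ∈ X × R a b)) →
  ∃[ Y ] (Y ⊆ X × length Y ≤ length Y' × (∀ {b} → b ∈ Y' → ∃[ a ] (a ∈ Y × R a b)))
sources R X []       has = [] , (λ ()) , z≤n , λ ()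
sources R X (b ∷ Y') has
  with has (here refl) | sources R X Y' (λ b∈ → has (there b∈))
... | a , a∈X , Rab | Y , Y⊆X , ∣Y∣≤ , srcY =
  a ∷ Y , ++-least {Ys = a ∷ []} (λ { (here refl) → a∈X }) Y⊆X , s≤s ∣Y∣≤ , src
  where
    src : ∀ {b'} → b' ∈ b ∷ Y' → ∃[ a' ] (a' ∈ a ∷ Y × R a' b')
    src (here refl) = a , here refl , Rab
    src (there b'∈) with srcY b'∈
    ... | a' , a'∈Y , Ra'b' = a' , there a'∈Y , Ra'b'

-- Supplementation: sup X F g = { g s m : s ∈ X, m ∈ F s }.  Both X[F/v]
-- (extending the domain) and the overwriting variant are instances.

sup : List A → (A → List B) → (A → B → C) → List C
sup X F g = concatMap (λ s → List.map (g s) (F s)) X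

∈-sup⁺ : {X : List A} {F : A → List B} {g : A → B → C} {s : A} {m : B} →
  s ∈ X → m ∈ F s → g s m ∈ sup X F g
∈-sup⁺ {F = F} {g} s∈X m∈Fs = ∈-concatMap⁺ (λ s → List.map (g s) (F s)) (lose s∈X (∈-map⁺ (g _) m∈Fs))

∈-sup⁻ : {X : List A} {F : A → List B} {g : A → B → C} {y : C} →
  y ∈ sup X F g → ∃[ s ] (s ∈ X × ∃[ m ] (m ∈ F s × y ≡ g s m))
∈-sup⁻ {X = X} {F} {g} y∈ with find (∈-concatMap⁻ (λ s → List.map (g s) (F s)) {xs = X} y∈)
... | s , s∈X , y∈Fs = s , s∈X , ∈-map⁻ (g s) y∈Fs

sup-mono : {Z X : List A} {F : A → List B} {g : A → B → C} →
  Z ⊆ X → sup Z F g ⊆ sup X F g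
sup-mono {F = F} {g} = concatMap⁺ (λ s → List.map (g s) (F s))

Anchors : (List A → Set) → List A → List A → Set
Anchors P Y X = ∀ Z → Y ⊆ Z → Z ⊆ X → P Z

record SmallAnchor {A : Set} (P : List A → Set) (X : List A) (b : ℕ) : Set where
  constructor anchor
  field
    team    : List A
    team⊆   : team ⊆ X
    small   : length team ≤ b
    anchors : Anchors P team X
open SmallAnchor public

SmallAnchor⇒small : {P : List A → Set} {X : List A} {b : ℕ} → SmallAnchor P X b →
  ∃[ Y ] (Y ⊆ X × length Y ≤ b × P Y)
SmallAnchor⇒small a = team a , team⊆ a , small a , anchors a (team a) ⊆-refl (team⊆ a)

downward-anchor : {P : List A → Set} {X : List A} →
  (∀ {Z} → Z ⊆ X → P Z) → SmallAnchor P X 0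
downward-anchor P↓ = anchor [] (λ ()) z≤n (λ _ _ Z⊆X → P↓ Z⊆X)

map-anchor : {P Q : List A → Set} {X : List A} {b c : ℕ} →
  (∀ {Z} → Z ⊆ X → P Z → Q Z) → b ≤ c → SmallAnchor P X b → SmallAnchor Q X c
map-anchor P⇒Q b≤c (anchor Y Y⊆X ∣Y∣≤b anc) =
  anchor Y Y⊆X (≤-trans ∣Y∣≤b b≤c) (λ Z Y⊆Z Z⊆X → P⇒Q Z⊆X (anc Z Y⊆Z Z⊆X))

∧-anchor : {P Q : List A → Set} {X : List A} {a b : ℕ} →
  SmallAnchor P X a → SmallAnchor Q X b → SmallAnchor (λ Z → P Z × Q Z) X (a + b)
∧-anchor (anchor Y₁ Y₁⊆X ∣Y₁∣≤ anc₁) (anchor Y₂ Y₂⊆X ∣Y₂∣≤ anc₂) =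
  anchor (Y₁ ++ Y₂) (++-least Y₁⊆X Y₂⊆X) (length-++-≤ {Ys = Y₁} ∣Y₁∣≤ ∣Y₂∣≤)
    λ Z Y⊆Z Z⊆X → anc₁ Z (⊆-trans (xs⊆xs++ys Y₁ Y₂) Y⊆Z) Z⊆X
                , anc₂ Z (⊆-trans (xs⊆ys++xs Y₂ Y₁) Y⊆Z) Z⊆X

-- Pull-back along supplementation: an anchor Y' of P inside sup X F g
-- yields Y ⊆ X with |Y| ≤ |Y'| anchoring "sup Z F g has P" inside X,
-- by choosing for every element of Y' one assignment it comes from.
sup-anchor : {P : List C → Set} {X : List A} (F : A → List B) (g : A → B → C) {b : ℕ} →
  SmallAnchor P (sup X F g) b → SmallAnchor (λ Z → P (sup Z F g)) X b
sup-anchor {X = X} F g (anchor Y' Y'⊆ ∣Y'∣≤ anc)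
  with sources (λ s y → ∃[ m ] (m ∈ F s × y ≡ g s m)) X Y' (λ y∈ → ∈-sup⁻ (Y'⊆ y∈))
... | Y , Y⊆X , ∣Y∣≤ , srcY =
  anchor Y Y⊆X (≤-trans ∣Y∣≤ ∣Y'∣≤)
    λ Z Y⊆Z Z⊆X → anc (sup Z F g) (Y'⊆supZ Y⊆Z) (sup-mono Z⊆X)
  where
    Y'⊆supZ : ∀ {Z} → Y ⊆ Z → Y' ⊆ sup Z F g
    Y'⊆supZ Y⊆Z y∈ with srcY y∈
    ... | s , s∈Y , m , m∈Fs , refl = ∈-sup⁺ (Y⊆Z s∈Y) m∈Fs

-- Existential supplementation: if F is nonempty on X, an anchor of
-- "sup Z F g has P" also anchors "some nonempty-valued F' has P on sup Z F' g",
-- since F stays nonempty on every subteam of X.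
∃sup-anchor : {P : List C → Set} {X : List A} (F : A → List B) (g : A → B → C) {b : ℕ} →
  (∀ s → s ∈ X → ∃[ m ] (m ∈ F s)) →
  SmallAnchor P (sup X F g) b →
  SmallAnchor (λ Z → ∃[ F' ] ((∀ s → s ∈ Z → ∃[ m ] (m ∈ F' s)) × P (sup Z F' g))) X b
∃sup-anchor F g F≠∅ anc =
  map-anchor (λ Z⊆X PsupZ → F , (λ s s∈Z → F≠∅ s (Z⊆X s∈Z)) , PsupZ) ≤-refl
    (sup-anchor F g anc)

Split : (List A → Set) → (List A → Set) → List A → Set
Split P Q Z = ∃[ Z₁ ] ∃[ Z₂ ] (Z₁ ⊆ Z × Z₂ ⊆ Z × (∀ s → s ∈ Z → s ∈ Z₁ ⊎ s ∈ Z₂)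
                               × P Z₁ × Q Z₂)

module _ {A : Set} (_≟_ : DecidableEquality A) where
  open import Data.List.Membership.DecPropositional _≟_ using (_∈?_)

  _∩_ : List A → List A → List A
  Z ∩ W = filter (_∈? W) Z

  ∩-⊆ˡ : (Z W : List A) → Z ∩ W ⊆ Z
  ∩-⊆ˡ Z W = filter-⊆ (_∈? W) Z

  ∩-⊆ʳ : (Z W : List A) → Z ∩ W ⊆ W
  ∩-⊆ʳ Z W s∈ = proj₂ (∈-filter⁻ (_∈? W) {xs = Z} s∈)

  ∈-∩ : {s : A} {Z W : List A} → s ∈ Z → s ∈ W → s ∈ Z ∩ W
  ∈-∩ {W = W} = ∈-filter⁺ (_∈? W)

  ∩-greatest : {Y Z W : List A} → Y ⊆ Z → Y ⊆ W → Y ⊆ Z ∩ W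
  ∩-greatest Y⊆Z Y⊆W s∈ = ∈-∩ (Y⊆Z s∈) (Y⊆W s∈)

  -- If X = X₁ ∪ X₂, anchors of P in X₁ and of Q in X₂ together anchor
  -- "Split P Q" in X: a team Z between splits as (Z ∩ X₁) ∪ (Z ∩ X₂).
  split-anchor : {P Q : List A → Set} {X X₁ X₂ : List A} {a b : ℕ} →
    X₁ ⊆ X → X₂ ⊆ X → (∀ s → s ∈ X → s ∈ X₁ ⊎ s ∈ X₂) →
    SmallAnchor P X₁ a → SmallAnchor Q X₂ b → SmallAnchor (Split P Q) X (a + b)
  split-anchor {X₁ = X₁} {X₂} X₁⊆X X₂⊆X cover
    (anchor Y₁ Y₁⊆ ∣Y₁∣≤ anc₁) (anchor Y₂ Y₂⊆ ∣Y₂∣≤ anc₂) =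
    anchor (Y₁ ++ Y₂) (++-least (⊆-trans Y₁⊆ X₁⊆X) (⊆-trans Y₂⊆ X₂⊆X))
      (length-++-≤ {Ys = Y₁} ∣Y₁∣≤ ∣Y₂∣≤) splits
    where
      splits : Anchors (Split _ _) (Y₁ ++ Y₂) _
      splits Z Y⊆Z Z⊆X =
        Z ∩ X₁ , Z ∩ X₂ , ∩-⊆ˡ Z X₁ , ∩-⊆ˡ Z X₂ ,
        (λ s s∈Z → Sum.map (∈-∩ s∈Z) (∈-∩ s∈Z) (cover s (Z⊆X s∈Z))) ,
        anc₁ (Z ∩ X₁) (∩-greatest (⊆-trans (xs⊆xs++ys Y₁ Y₂) Y⊆Z) Y₁⊆) (∩-⊆ʳ Z X₁) ,
        anc₂ (Z ∩ X₂) (∩-greatest (⊆-trans (xs⊆ys++xs Y₂ Y₁) Y⊆Z) Y₂⊆) (∩-⊆ʳ Z X₂)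

module _ {L : Signature} {I : Set} {ar : I → ℕ}
         (D : (i : I) → DependencyNotion (ar i)) (𝔐 : Structure L) where

  open Semantics D 𝔐

  private
    n : ℕ
    n = size 𝔐

    instance
      nonEmpty𝔐 : NonZero n
      nonEmpty𝔐 = nonEmpty 𝔐

  _≟ₐ_ : ∀ {k} → DecidableEquality (Assignment n k)
  _≟ₐ_ = ≡-dec Fin._≟_

  teamRel-mono : ∀ {k a} {Y Z : Team n k} (vs : Vec (Fin k) a) →
    Y ⊆ Z → ∀ t → teamRel Y vs t → teamRel Z vs t
  teamRel-mono vs Y⊆Z t (s , s∈Y , s[vs]≡t) = s , Y⊆Z s∈Y , s[vs]≡t

  -- An atom D v̄ with D upwards closed and γ-bounded is anchored by the
  -- γ(|M|)-sized witness given by boundedness: by upward closure every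
  -- larger team still satisfies the atom.
  dep-anchor : ∀ {a} {𝐃 : DependencyNotion a} {γ : ℕ → ℕ} →
    UpwardsClosed 𝐃 → Bounded γ 𝐃 →
    ∀ {k} (X : Team n k) (vs : Vec (Fin k) a) → holds 𝐃 n (teamRel X vs) →
    SmallAnchor (λ Z → holds 𝐃 n (teamRel Z vs)) X (γ n)
  dep-anchor up bounded {k} X vs X⊨ with bounded n k X vs X⊨
  ... | Y , Y⊆X , ∣Y∣≤ , Y⊨ =
    anchor Y Y⊆X ∣Y∣≤ λ Z Y⊆Z _ →
      up n (teamRel Y vs) (teamRel Z vs) Y⊨ (teamRel-mono vs Y⊆Z)

  module _ (γ : I → ℕ → ℕ) (up : ∀ i → UpwardsClosed (D i))
           (bounded : ∀ i → Bounded (γ i) (D i)) where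

    -- Main lemma: every team satisfying φ has an anchor of size ≤ ν_φ(|M|).
    -- First-order literals and constancy atoms are flat, hence downward
    -- closed, and need no anchor at all.
    smallAnchor : ∀ {k} (φ : Formula L ar k) (X : Team n k) → X ⊨ φ →
      SmallAnchor (_⊨ φ) X (ν γ φ n)
    smallAnchor (rel R ts)  X X⊨ = downward-anchor λ Z⊆X s s∈Z → X⊨ s (Z⊆X s∈Z)
    smallAnchor (nrel R ts) X X⊨ = downward-anchor λ Z⊆X s s∈Z → X⊨ s (Z⊆X s∈Z)
    smallAnchor (eq t u)    X X⊨ = downward-anchor λ Z⊆X s s∈Z → X⊨ s (Z⊆X s∈Z)
    smallAnchor (neq t u)   X X⊨ = downward-anchor λ Z⊆X s s∈Z → X⊨ s (Z⊆X s∈Z)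
    smallAnchor (const vs)  X X⊨ =
      downward-anchor λ Z⊆X s s' s∈Z s'∈Z → X⊨ s s' (Z⊆X s∈Z) (Z⊆X s'∈Z)
    smallAnchor (dep i vs)  X X⊨ = dep-anchor {𝐃 = D i} (up i) (bounded i) X vs X⊨
    smallAnchor (φ ∨' ψ) X (X₁ , X₂ , X₁⊆X , X₂⊆X , cover , X₁⊨ , X₂⊨) =
      split-anchor _≟ₐ_ X₁⊆X X₂⊆X cover (smallAnchor φ X₁ X₁⊨) (smallAnchor ψ X₂ X₂⊨)
    smallAnchor (φ ∧' ψ) X (X⊨φ , X⊨ψ) = ∧-anchor (smallAnchor φ X X⊨φ) (smallAnchor ψ X X⊨ψ)
    smallAnchor (φ ⊔' ψ) X (inj₁ X⊨φ) = map-anchor (λ _ → inj₁) (m≤m+n _ _) (smallAnchor φ X X⊨φ)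
    smallAnchor (φ ⊔' ψ) X (inj₂ X⊨ψ) = map-anchor (λ _ → inj₂) (m≤n+m _ _) (smallAnchor ψ X X⊨ψ)
    smallAnchor (∃⁺ φ) X (F , F≠∅ , X[F]⊨) =
      ∃sup-anchor F (λ s m → m ∷ s) F≠∅ (smallAnchor φ (supNew X F) X[F]⊨)
    smallAnchor (∀⁺ φ) X X[M]⊨ =
      sup-anchor (λ _ → allFin n) (λ s m → m ∷ s) (smallAnchor φ _ X[M]⊨)
    smallAnchor (∃ᵒ v φ) X (F , F≠∅ , X[F]⊨) =
      ∃sup-anchor F (λ s m → s [ v ]≔ m) F≠∅ (smallAnchor φ (supOld v X F) X[F]⊨)
    smallAnchor (∀ᵒ v φ) X X[M]⊨ =
      sup-anchor (λ _ → allFin n) (λ s m → s [ v ]≔ m) (smallAnchor φ _ X[M]⊨)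

mainTheorem11 : {L : Signature} {I : Set} {ar : I → ℕ}
    (D : (i : I) → DependencyNotion (ar i)) (γ : I → ℕ → ℕ) →
    (∀ i → UpwardsClosed (D i)) →
    (∀ i → Bounded (γ i) (D i)) →
    ∀ {k} (φ : Formula L ar k) (𝔐 : Structure L) (X : Team (size 𝔐) k) →
    Semantics._⊨_ D 𝔐 X φ →
    ∃[ Y ] (Y ⊆ X × length Y ≤ ν γ φ (size 𝔐) × Semantics._⊨_ D 𝔐 Y φ)
mainTheorem11 D γ up bounded φ 𝔐 X X⊨φ =
  SmallAnchor⇒small (smallAnchor D 𝔐 γ up bounded φ X X⊨φ)
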